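{- Let $n\ge 3$. Coxeter–Conway frieze patterns of positive integers of width $n-3$ (frieze patterns differing by an index shift $(i,j)\mapsto(i+s,j+s)$ being identified) are in one-to-one correspondence with normalized Farey $n$-gons up to cyclic equivalence. The correspondence is given by taking ratios of two consecutive rows: to the frieze $(c_{i,j})$ one associates $v_j=\frac{c_{k,k-1+j}}{c_{k+1,k-1+j}}$, $j=0,\ldots,n-1$ (for any $k$), and conversely a normalized Farey $n$-gon $v_j=\frac{a_j}{b_j}$ ($v_0=\frac10$, $v_{n-1}=\frac01$) determines the frieze whose two consecutive rows are $(a_0,\ldots,a_{n-1})$ and $(b_0,\ldots,b_{n-1})$.
   Context: A Coxeter–Conway frieze pattern of width $n-3$ is an array $c_{i,j}$, $i-2\le j\le i+n-2$, with $c_{i,i-2}=c_{i,i+n-2}=0$, $c_{i,i-1}=c_{i,i+n-3}=1$, and $c_{i,j}c_{i+1,j+1}-c_{i,j+1}c_{i+1,j}=1$ whenever all four entries are defined; it is of positive integers if $c_{i,j}\in\mathbb{Z}_{>0}$ for $i\le j\le i+n-4$. Rationals are written as irreducible fractions $\frac pr$, $r\ge0$, $\infty=\frac10$; Farey distance $d(\frac{p_1}{r_1},\frac{p_2}{r_2})=|p_1r_2-p_2r_1|$; the Farey graph joins $v,w$ iff $d(v,w)=1$. A Farey $n$-gon is a sequence $\infty\ge v_0>\cdots>v_{n-1}\ge0$ with $v_i,v_{i+1}$ and $v_{n-1},v_0$ joined by Farey edges; normalized means $v_0=\infty$, $v_{n-1}=0$. Cyclic equivalence: the normalized $n$-gon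 $(v_0,\ldots,v_{n-1})$ is cyclically equivalent to the normalized $n$-gon $(g(v_1),\ldots,g(v_{n-1}),g(v_0))$, where $g\in\mathrm{SL}_2(\mathbb{Z})$ acts by Möbius transformations and satisfies $g(v_1)=\infty$, $g(v_0)=0$; cyclic equivalence is the equivalence relation generated by this. -}

module Defs where

open import Data.Nat as ℕ using (ℕ; zero; suc)
open import Data.Integer as ℤ using (ℤ; +_; -[1+_]; +[1+_])
open import Data.Rational as ℚ using (ℚ; ↥_; ↧_; 0ℚ)
open import Data.Product using (Σ; ∃; _×_; _,_)
open import Data.Sum using (_⊎_)
open import Relation.Binary.PropositionalEquality using (_≡_)
open import Relation.Binary.Construct.Closure.Equivalence using (EqClosure)

-- A frieze is a function c : ℤ → ℤ → ℤ, c i j = c_{i,j}; only the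
-- entries in the band i-2 ≤ j ≤ i+n-2 are meaningful (values outside
-- the band are ignored by every definition below).

InBand : ℕ → ℤ → ℤ → Set
InBand n i j = (i ℤ.- + 2 ℤ.≤ j) × (j ℤ.≤ i ℤ.+ + n ℤ.- + 2)

record Frieze (n : ℕ) (c : ℤ → ℤ → ℤ) : Set where
  field
    zeroˡ : ∀ i → c i (i ℤ.- + 2) ≡ + 0
    zeroʳ : ∀ i → c i (i ℤ.+ + n ℤ.- + 2) ≡ + 0
    oneˡ  : ∀ i → c i (i ℤ.- + 1) ≡ + 1
    oneʳ  : ∀ i → c i (i ℤ.+ + n ℤ.- + 3) ≡ + 1
    unimodular : ∀ i j →
      InBand n i j → InBand n i (j ℤ.+ + 1) →
      InBand n (i ℤ.+ + 1) j → InBand n (i ℤ.+ + 1) (j ℤ.+ + 1) →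
      c i j ℤ.* c (i ℤ.+ + 1) (j ℤ.+ + 1)
        ℤ.- c i (j ℤ.+ + 1) ℤ.* c (i ℤ.+ + 1) j ≡ + 1
    positive : ∀ i j → i ℤ.≤ j → j ℤ.≤ i ℤ.+ + n ℤ.- + 4 → + 0 ℤ.< c i j

ShiftEq : ℕ → (ℤ → ℤ → ℤ) → (ℤ → ℤ → ℤ) → Set
ShiftEq n c c' = ∃ λ s → ∀ i j → InBand n i j → c' i j ≡ c (i ℤ.+ s) (j ℤ.+ s)

-- Extended rationals ℚ ∪ {∞}, as irreducible fractions p/r, r ≥ 0, ∞ = 1/0.

data ℚ∞ : Set where
  ∞   : ℚ∞
  fin : ℚ → ℚ∞

num : ℚ∞ → ℤ
num ∞       = + 1
num (fin q) = ↥ q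

den : ℚ∞ → ℤ
den ∞       = + 0
den (fin q) = ↧ q

frac : ℤ → ℤ → ℚ∞
frac p (+ zero)    = ∞
frac p +[1+ m ]    = fin (p ℚ./ suc m)
frac p (-[1+ m ])  = fin ((ℤ.- p) ℚ./ suc m)

dist : ℚ∞ → ℚ∞ → ℕ
dist v w = ℤ.∣ num v ℤ.* den w ℤ.- num w ℤ.* den v ∣

FareyEdge : ℚ∞ → ℚ∞ → Set
FareyEdge v w = dist v w ≡ 1

data _>∞_ : ℚ∞ → ℚ∞ → Set where
  ∞>fin  : ∀ {q} → ∞ >∞ fin q
  fin>fin : ∀ {p q} → q ℚ.< p → fin p >∞ fin q

data _≥∞_ : ℚ∞ → ℚ∞ → Set where
  ∞≥ : ∀ {v} → ∞ ≥∞ v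
  fin≥fin : ∀ {p q} → q ℚ.≤ p → fin p ≥∞ fin q

-- Farey n-gons. A sequence v_0,…,v_{n-1} is a function ℕ → ℚ∞ of which
-- only the values at 0,…,n-1 matter.

record FareyPolygon (n : ℕ) (v : ℕ → ℚ∞) : Set where
  field
    top       : ∞ ≥∞ v 0
    decr      : ∀ i → suc i ℕ.< n → v i >∞ v (suc i)
    bottom    : v (n ℕ.∸ 1) ≥∞ fin 0ℚ
    edges     : ∀ i → suc i ℕ.< n → FareyEdge (v i) (v (suc i))
    closeEdge : FareyEdge (v (n ℕ.∸ 1)) (v 0)

record NormFareyPolygon (n : ℕ) (v : ℕ → ℚ∞) : Set where
  field
    polygon : FareyPolygon n v
    first   : v 0 ≡ ∞
    last    : v (n ℕ.∸ 1) ≡ fin 0ℚ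

record SL2 : Set where
  field
    a b c d : ℤ
    det : a ℤ.* d ℤ.- b ℤ.* c ≡ + 1

act : SL2 → ℚ∞ → ℚ∞
act g v = frac (a ℤ.* num v ℤ.+ b ℤ.* den v) (c ℤ.* num v ℤ.+ d ℤ.* den v)
  where open SL2 g

SameSeq : ℕ → (ℕ → ℚ∞) → (ℕ → ℚ∞) → Set
SameSeq n v w = ∀ j → j ℕ.< n → v j ≡ w j

Rotate : ℕ → (ℕ → ℚ∞) → (ℕ → ℚ∞) → Set
Rotate n v w =
  NormFareyPolygon n v × NormFareyPolygon n w ×
  Σ SL2 λ g → act g (v 1) ≡ ∞ × act g (v 0) ≡ fin 0ℚ ×
    (∀ j → suc j ℕ.< n → w j ≡ act g (v (suc j))) ×
    w (n ℕ.∸ 1) ≡ act g (v 0)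

CycStep : ℕ → (ℕ → ℚ∞) → (ℕ → ℚ∞) → Set
CycStep n v w = SameSeq n v w ⊎ Rotate n v w

CycEq : ℕ → (ℕ → ℚ∞) → (ℕ → ℚ∞) → Set
CycEq n = EqClosure (CycStep n)

ratios : (ℤ → ℤ → ℤ) → ℤ → ℕ → ℚ∞
ratios c k j = frac (c k (k ℤ.- + 1 ℤ.+ + j)) (c (k ℤ.+ + 1) (k ℤ.- + 1 ℤ.+ + j))

-- A frieze is read in band coordinates e i t = c_{i,i-2+t}, 0 ≤ t ≤ n
-- (BandFrieze).  Columns of two consecutive rows k, k+1 give coprime pairs
-- (e k (t+1), e (k+1) t), and the unimodular rule says consecutive pairs have
-- determinant 1, so their ratios form a normalized Farey polygon.  The unimodular
-- rule implies the diagonal recurrence c_{k+2,j} + c_{k,j} = c_{k,k} c_{k+1,j};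
-- it shows that passing from rows (k,k+1) to (k+1,k+2) is the Möbius map of
-- rot c_{k,k} = [[0,1],[-1,c_{k,k}]], i.e. a cyclic move, and that a frieze is
-- determined by two consecutive rows (Uniqueness).  Conversely the vertex
-- vectors of a normalized Farey n-gon, extended n-antiperiodically to U : ℤ → ℤ²,
-- give the frieze c_{i,j} = det(U_{i-1}, U_{j+1}) (Plücker relation for the
-- unimodular rule, convexity of the polygon for positivity).  Injectivity on
-- classes: cyclic moves preserve "being the row ratios of a given frieze"
-- (Injectivity), so cyclically equivalent ratios come from shifted friezes.

module Submission where

open import Defs
open import Data.Nat as ℕ using (ℕ; zero; suc; _≤_; _<_; z≤n; s≤s; z<s)
open import Data.Integer as ℤ using (ℤ; +_; -[1+_]; +[1+_]; _+_; _*_; _-_; -_; +≤+; +<+)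
import Data.Nat.Properties as ℕP
import Data.Nat.DivMod as ℕD
import Data.Nat.Divisibility as ℕDiv
import Data.Integer.Properties as ℤP
import Data.Integer.DivMod as ℤD
import Data.Integer.GCD as ℤG
import Data.Integer.Divisibility.Signed as ℤS
open import Data.Rational as ℚ using (↥_; ↧_; 0ℚ; mkℚ)
import Data.Rational.Properties as ℚP
open import Data.Product using (Σ; ∃; _×_; _,_; proj₁; proj₂)
open import Data.Sum using (_⊎_; inj₁; inj₂; [_,_]′)
open import Relation.Nullary using (yes; no; ¬_)
open import Relation.Nullary.Negation using (contradiction)
open import Relation.Binary.PropositionalEquality
open import Data.Integer.Tactic.RingSolver using (solve-∀)
import Relation.Binary.Construct.Closure.Equivalence as EqClosure
open import Relation.Binary.Construct.Closure.Symmetric using (fwd; bwd)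
open import Relation.Binary.Construct.Closure.ReflexiveTransitive using (ε; _◅_)

≤⇒offset : ∀ {a b} → a ℤ.≤ b → Σ ℕ λ t → b ≡ a + + t
≤⇒offset {a} {b} a≤b = ℤ.∣ b - a ∣ , sym (begin
    a + + ℤ.∣ b - a ∣ ≡⟨ cong (λ x → a + x) (ℤP.0≤i⇒+∣i∣≡i (ℤP.i≤j⇒0≤j-i a≤b)) ⟩
    a + (b - a)       ≡⟨ a+[b-a]≡b a b ⟩
    b                 ∎)
  where
  open ≡-Reasoning
  a+[b-a]≡b : ∀ a b → a + (b - a) ≡ b
  a+[b-a]≡b = solve-∀

offset-cancel : ∀ a t s → a + + t ℤ.≤ a + + s → t ≤ s
offset-cancel a t s h with subst₂ ℤ._≤_ (cancel a (+ t)) (cancel a (+ s)) (ℤP.+-monoʳ-≤ (- a) h)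
  where
  cancel : ∀ a x → - a + (a + x) ≡ x
  cancel = solve-∀
... | +≤+ t≤s = t≤s

ℤ-induction : ∀ {ℓ} (P : ℤ → Set ℓ) (k : ℤ) → P k →
              (∀ i → P i → P (i + + 1)) → (∀ i → P (i + + 1) → P i) → ∀ i → P i
ℤ-induction P k base up down i =
  [ (λ k≤i → let t , i≡k+t = ≤⇒offset k≤i in subst P (sym i≡k+t) (above t))
  , (λ i≤k → let t , k≡i+t = ≤⇒offset i≤k in below t i k≡i+t)
  ]′ (ℤP.≤-total k i)
  where
  successor : ∀ a T → a + (+ 1 + T) ≡ a + T + + 1
  successor = solve-∀

  above : ∀ t → P (k + + t)
  above zero    = subst P (sym (ℤP.+-identityʳ k)) base
  above (suc t) = subst P (sym (successor k (+ t))) (up (k + + t) (above t))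

  below : ∀ t i → k ≡ i + + t → P i
  below zero    i k≡i+0   = subst P (trans k≡i+0 (ℤP.+-identityʳ i)) base
  below (suc t) i k≡i+t+1 = down i (below t (i + + 1) (trans k≡i+t+1 (sym (ℤP.+-assoc i (+ 1) (+ t)))))

-- Integer vectors; the vector (p , q) stands for the fraction p/q.
ℤ² : Set
ℤ² = ℤ × ℤ

det : ℤ² → ℤ² → ℤ
det (a , b) (c , d) = a * d - c * b

neg : ℤ² → ℤ²
neg (a , b) = - a , - b

neg-involutive : ∀ A → neg (neg A) ≡ A
neg-involutive (a , b) = cong₂ _,_ (ℤP.neg-involutive a) (ℤP.neg-involutive b)

det-neg-neg : ∀ A B → det (neg A) (neg B) ≡ det A B
det-neg-neg (a , b) (c , d) = identity a b c d
  where
  identity : ∀ a b c d → (- a) * (- d) - (- c) * (- b) ≡ a * d - c * b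
  identity = solve-∀

det-negʳ : ∀ A B → det A (neg B) ≡ det B A
det-negʳ (a , b) (c , d) = identity a b c d
  where
  identity : ∀ a b c d → a * (- d) - (- c) * b ≡ c * b - a * d
  identity = solve-∀

det-self : ∀ A → det A A ≡ + 0
det-self (a , b) = identity a b
  where
  identity : ∀ a b → a * b - a * b ≡ + 0
  identity = solve-∀

plücker : ∀ A B C D → det A C * det B D - det A D * det B C ≡ det A B * det C D
plücker (a₁ , a₂) (b₁ , b₂) (c₁ , c₂) (d₁ , d₂) = identity a₁ a₂ b₁ b₂ c₁ c₂ d₁ d₂
  where
  identity : ∀ a₁ a₂ b₁ b₂ c₁ c₂ d₁ d₂ →
    (a₁ * c₂ - c₁ * a₂) * (b₁ * d₂ - d₁ * b₂) - (a₁ * d₂ - d₁ * a₂) * (b₁ * c₂ - c₁ * b₂)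
      ≡ (a₁ * b₂ - b₁ * a₂) * (c₁ * d₂ - d₁ * c₂)
  identity = solve-∀

-- The antiperiodic extension to ℤ of a sequence f given on 0,…,n-1 (n = suc p),
-- for an involution flip: extend (x + n) = flip (extend x).  Writing x = r + q n
-- with 0 ≤ r < n, extend x is f r flipped q times (for x = -(y+1) one has
-- r = p - y mod n and q = -(y div n + 1)).
module Antiperiodic {A : Set} (flip : A → A) (flip-involutive : ∀ a → flip (flip a) ≡ a)
                    (p : ℕ) (f : ℕ → A) where

  private
    n : ℕ
    n = suc p

  flipⁿ : ℕ → A → A
  flipⁿ zero    a = a
  flipⁿ (suc k) a = flip (flipⁿ k a)

  extend : ℤ → A
  extend (+ x)     = flipⁿ (x ℕD./ n) (f (x ℕD.% n))
  extend -[1+ y ] = flipⁿ (suc (y ℕD./ n)) (f (p ℕ.∸ y ℕD.% n))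

  extend-base : ∀ r → r < n → extend (+ r) ≡ f r
  extend-base r r<n rewrite ℕD.m<n⇒m/n≡0 r<n | ℕD.m<n⇒m%n≡m r<n = refl

  -- adding n raises the quotient by one and keeps the remainder
  private
    quotient-shift : ∀ x → (x ℕ.+ n) ℕD./ n ≡ suc (x ℕD./ n)
    quotient-shift x = trans (ℕD.m/n≡1+[m∸n]/n (ℕP.m≤n+m n x)) (cong (λ y → suc (y ℕD./ n)) (ℕP.m+n∸n≡m x n))

    extend-shift-+ : ∀ x → extend (+ (x ℕ.+ n)) ≡ flip (extend (+ x))
    extend-shift-+ x = cong₂ (λ q r → flipⁿ q (f r)) (quotient-shift x) (ℕD.[m+n]%n≡m%n x n)

    extend-shift-below : ∀ y → extend (-[1+ y ℕ.+ n ] + + n) ≡ flip (extend -[1+ y ℕ.+ n ])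
    extend-shift-below y = begin
      extend (-[1+ y ℕ.+ n ] + + n)  ≡⟨ cong extend (drop-n (+ y) (+ n)) ⟩
      extend -[1+ y ]                ≡⟨ flip-involutive _ ⟨
      flip (flip (extend -[1+ y ]))  ≡⟨ cong₂ (λ q r → flip (flipⁿ (suc q) (f (p ℕ.∸ r))))
                                              (quotient-shift y) (ℕD.[m+n]%n≡m%n y n) ⟨
      flip (extend -[1+ y ℕ.+ n ])   ∎
      where
      open ≡-Reasoning
      drop-n : ∀ a b → - (+ 1 + (a + b)) + b ≡ - (+ 1 + a)
      drop-n = solve-∀

  extend-shift : ∀ x → extend (x + + n) ≡ flip (extend x)
  extend-shift (+ x) = extend-shift-+ x
  extend-shift -[1+ y ] with y ℕ.<? n
  ... | yes y<n rewrite ℕD.m<n⇒m/n≡0 y<n | ℕD.m<n⇒m%n≡m y<n =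
    trans (cong extend (ℤP.⊖-≥ {suc p} {suc y} y<n))
          (trans (extend-base (p ℕ.∸ y) (s≤s (ℕP.m∸n≤m p y))) (sym (flip-involutive _)))
  ... | no y≮n = subst (λ z → extend (-[1+ z ] + + n) ≡ flip (extend -[1+ z ]))
                       (ℕP.m∸n+n≡m (ℕP.≮⇒≥ y≮n)) (extend-shift-below (y ℕ.∸ n))

module Translation (n : ℕ) .{{_ : ℕ.NonZero n}} {B : Set} (F : ℤ → ℤ → B)
                   (invariant : ∀ x y → F (x + + n) (y + + n) ≡ F x y) where

  private
    invariant-+ : ∀ t x y → F (x + + t * + n) (y + + t * + n) ≡ F x y
    invariant-+ zero    x y = cong₂ F (ℤP.+-identityʳ x) (ℤP.+-identityʳ y)
    invariant-+ (suc t) x y =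
      trans (cong₂ F (one-more x (+ t) (+ n)) (one-more y (+ t) (+ n)))
            (trans (invariant _ _) (invariant-+ t x y))
      where
      one-more : ∀ x t n → x + (+ 1 + t) * n ≡ x + t * n + n
      one-more = solve-∀

  invariant-multiple : ∀ q x y → F (x + q * + n) (y + q * + n) ≡ F x y
  invariant-multiple (+ t)    x y = invariant-+ t x y
  invariant-multiple -[1+ t ] x y =
    trans (sym (invariant-+ (suc t) _ _)) (cong₂ F (cancel x (+ suc t) (+ n)) (cancel y (+ suc t) (+ n)))
    where
    cancel : ∀ x t n → x + (- t) * n + t * n ≡ x
    cancel = solve-∀

  reduce : ∀ x d → F x (x + + d) ≡ F (+ (x ℤD.%ℕ n)) (+ (x ℤD.%ℕ n ℕ.+ d))
  reduce x d = begin
      F x (x + + d)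
        ≡⟨ cong₂ F x≡r+qn (cong (_+ + d) x≡r+qn) ⟩
      F (+ r + q * + n) (+ r + q * + n + + d)
        ≡⟨ cong (F (+ r + q * + n)) (swap (+ r) (q * + n) (+ d)) ⟩
      F (+ r + q * + n) (+ r + + d + q * + n)
        ≡⟨ invariant-multiple q (+ r) (+ r + + d) ⟩
      F (+ r) (+ (r ℕ.+ d)) ∎
    where
    open ≡-Reasoning
    r = x ℤD.%ℕ n
    q = x ℤD./ℕ n
    x≡r+qn : x ≡ + r + q * + n
    x≡r+qn = ℤD.a≡a%ℕn+[a/ℕn]*n x n
    swap : ∀ a b c → a + b + c ≡ a + c + b
    swap = solve-∀

Coprime : ℤ → ℤ → Set
Coprime p q = Σ ℤ λ x → Σ ℤ λ y → x * p + y * q ≡ + 1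

unimodular⇒coprime : ∀ p q r s → p * r - s * q ≡ + 1 → Coprime p q
unimodular⇒coprime p q r s h = r , - s , trans (identity p q r s) h
  where
  identity : ∀ p q r s → r * p + (- s) * q ≡ p * r - s * q
  identity = solve-∀

-- A common divisor of p and q divides every combination x p + y q.
coprime⇒gcd≡1 : ∀ p q → Coprime p q → ℤG.gcd p q ≡ + 1
coprime⇒gcd≡1 p q (x , y , xp+yq≡1) = cong +_ (ℕDiv.∣1⇒≡1 (ℤS.∣⇒∣ᵤ gcd∣1))
  where
  gcd∣1 : ℤG.gcd p q ℤS.∣ + 1
  gcd∣1 = subst (ℤG.gcd p q ℤS.∣_) xp+yq≡1
            (ℤS.∣m∣n⇒∣m+n (ℤS.∣n⇒∣m*n x (ℤS.∣ᵤ⇒∣ (ℤG.gcd[i,j]∣i p q)))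
                          (ℤS.∣n⇒∣m*n y (ℤS.∣ᵤ⇒∣ (ℤG.gcd[i,j]∣j p q))))

frac-reduced-pos : ∀ p m → Coprime p +[1+ m ] →
                   num (frac p +[1+ m ]) ≡ p × den (frac p +[1+ m ]) ≡ +[1+ m ]
frac-reduced-pos p m cop =
    trans (sym (ℤP.*-identityʳ _)) (trans (cong (↥ (p ℚ./ suc m) *_) (sym gcd≡1)) (ℚP.↥-/ p (suc m)))
  , trans (sym (ℤP.*-identityʳ _)) (trans (cong (↧ (p ℚ./ suc m) *_) (sym gcd≡1)) (ℚP.↧-/ p (suc m)))
  where
  gcd≡1 = coprime⇒gcd≡1 p +[1+ m ] cop

frac-neg : ∀ p q → frac (- p) (- q) ≡ frac p q
frac-neg p (+ zero)  = refl
frac-neg p +[1+ m ] rewrite ℤP.neg-involutive p = refl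
frac-neg p -[1+ m ] = refl

private
  coprime-neg : ∀ p q → Coprime p (- q) → Coprime (- p) q
  coprime-neg p q (x , y , e) = - x , - y , trans (identity x y p q) e
    where
    identity : ∀ x y p q → (- x) * (- p) + (- y) * q ≡ x * p + y * (- q)
    identity = solve-∀

  abs≡1 : ∀ x → ℤ.∣ x ∣ ≡ 1 → x ≡ + 1 ⊎ x ≡ - + 1
  abs≡1 (+ suc zero)    _ = inj₁ refl
  abs≡1 -[1+ zero ]     _ = inj₂ refl
  abs≡1 (+ zero)        ()
  abs≡1 (+ suc (suc k)) ()
  abs≡1 -[1+ suc k ]    ()

frac-reduced : ∀ p q → Coprime p q →
  (num (frac p q) ≡ p × den (frac p q) ≡ q) ⊎ (num (frac p q) ≡ - p × den (frac p q) ≡ - q)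
frac-reduced p +[1+ m ] cop = inj₁ (frac-reduced-pos p m cop)
frac-reduced p -[1+ m ] cop = inj₂ (frac-reduced-pos (- p) m (coprime-neg p +[1+ m ] cop))
frac-reduced p (+ zero) (x , y , xp+y0≡1) with abs≡1 p (ℕP.m*n≡1⇒n≡1 ℤ.∣ x ∣ ℤ.∣ p ∣ ∣xp∣≡1)
  where
  ∣xp∣≡1 : ℤ.∣ x ∣ ℕ.* ℤ.∣ p ∣ ≡ 1
  ∣xp∣≡1 = trans (sym (ℤP.abs-* x p)) (cong ℤ.∣_∣ (trans (add-zero x p y) xp+y0≡1))
    where
    add-zero : ∀ x p y → x * p ≡ x * p + y * + 0
    add-zero = solve-∀
... | inj₁ refl = inj₁ (refl , refl)
... | inj₂ refl = inj₂ (refl , refl)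

frac-normal : ∀ p q → Coprime p q → + 0 ℤ.≤ q → (q ≡ + 0 → p ≡ + 1) →
              num (frac p q) ≡ p × den (frac p q) ≡ q
frac-normal p +[1+ m ] cop _ _   = frac-reduced-pos p m cop
frac-normal p (+ zero) _   _ q≡0⇒p≡1 = sym (q≡0⇒p≡1 refl) , refl

frac-numden : ∀ v → frac (num v) (den v) ≡ v
frac-numden ∞                  = refl
frac-numden (fin q@(mkℚ _ _ _)) = cong fin (ℚP.↥p/↧p≡p q)

frac≡∞⇒den≡0 : ∀ p q → frac p q ≡ ∞ → q ≡ + 0
frac≡∞⇒den≡0 p (+ zero) _ = refl
frac≡∞⇒den≡0 p +[1+ d ] ()
frac≡∞⇒den≡0 p -[1+ d ] ()

frac≡0⇒num≡0 : ∀ p q → frac p q ≡ fin 0ℚ → p ≡ + 0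
frac≡0⇒num≡0 p (+ zero) ()
frac≡0⇒num≡0 p +[1+ d ] eq = trans (sym (ℚP.↥-/ p (suc d)))
  (trans (cong (λ r → ↥ r * ℤG.gcd p (+ suc d)) (fin-injective eq)) (ℤP.*-zeroˡ (ℤG.gcd p (+ suc d))))
  where
  fin-injective : ∀ {r s} → fin r ≡ fin s → r ≡ s
  fin-injective refl = refl
frac≡0⇒num≡0 p -[1+ d ] eq = trans (sym (ℤP.neg-involutive p)) (cong -_ (frac≡0⇒num≡0 (- p) +[1+ d ] eq))

act-frac : ∀ g p q → Coprime p q →
           act g (frac p q) ≡ frac (SL2.a g * p + SL2.b g * q) (SL2.c g * p + SL2.d g * q)
act-frac g p q cop with frac-reduced p q cop
... | inj₁ (num≡p , den≡q) rewrite num≡p | den≡q = refl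
... | inj₂ (num≡-p , den≡-q) rewrite num≡-p | den≡-q =
  trans (cong₂ frac (negate (SL2.a g) (SL2.b g) p q) (negate (SL2.c g) (SL2.d g) p q)) (frac-neg _ _)
  where
  negate : ∀ a b p q → a * (- p) + b * (- q) ≡ - (a * p + b * q)
  negate = solve-∀

rot : ℤ → SL2
rot x = record { a = + 0 ; b = + 1 ; c = - + 1 ; d = x ; det = det≡1 x }
  where
  det≡1 : ∀ x → + 0 * x - + 1 * (- + 1) ≡ + 1
  det≡1 = solve-∀

rot-∞ : ∀ x → act (rot x) ∞ ≡ fin 0ℚ
rot-∞ x = cong (λ z → frac (+ 0) (- + 1 + z)) (ℤP.*-zeroʳ x)

rot-x : ∀ x → act (rot x) (frac x (+ 1)) ≡ ∞
rot-x x = trans (act-frac (rot x) x (+ 1) (+ 0 , + 1 , refl)) (cong (frac _) (cancel x))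
  where
  cancel : ∀ x → - + 1 * x + x * + 1 ≡ + 0
  cancel = solve-∀

private
  product≡-1 : ∀ b c → b * c ≡ - + 1 → (b ≡ - + 1 × c ≡ + 1) ⊎ (b ≡ + 1 × c ≡ - + 1)
  product≡-1 b c bc≡-1 with abs≡1 b ∣b∣≡1 | abs≡1 c ∣c∣≡1
    where
    ∣bc∣≡1 : ℤ.∣ b ∣ ℕ.* ℤ.∣ c ∣ ≡ 1
    ∣bc∣≡1 = trans (sym (ℤP.abs-* b c)) (cong ℤ.∣_∣ bc≡-1)
    ∣b∣≡1 = ℕP.m*n≡1⇒m≡1 ℤ.∣ b ∣ ℤ.∣ c ∣ ∣bc∣≡1
    ∣c∣≡1 = ℕP.m*n≡1⇒n≡1 ℤ.∣ b ∣ ℤ.∣ c ∣ ∣bc∣≡1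
  ... | inj₁ refl | inj₁ refl = contradiction bc≡-1 λ ()
  ... | inj₁ refl | inj₂ refl = inj₂ (refl , refl)
  ... | inj₂ refl | inj₁ refl = inj₁ (refl , refl)
  ... | inj₂ refl | inj₂ refl = contradiction bc≡-1 λ ()

  isolate-d : ∀ c x d → c * x + d ≡ + 0 → d ≡ - (c * x)
  isolate-d c x d h = trans (isolate c x d) (trans (cong (λ z → z - c * x) h) (ℤP.+-identityˡ _))
    where
    isolate : ∀ c x d → d ≡ c * x + d - c * x
    isolate = solve-∀

-- An SL₂ matrix with a = 0 and c x + d = 0 is ± rot x, so it acts like rot x.
act-rot-unique : ∀ g x → SL2.a g ≡ + 0 → SL2.c g * x + SL2.d g ≡ + 0 → ∀ w → act g w ≡ act (rot x) w
act-rot-unique record { a = a ; b = b ; c = c ; d = d ; det = det } x refl cx+d≡0 w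
  with product≡-1 b c (trans (from-det b c d) (cong -_ det))
  where
  from-det : ∀ b c d → b * c ≡ - (+ 0 * d - b * c)
  from-det = solve-∀
-- g = rot x
... | inj₂ (refl , refl) rewrite isolate-d (- + 1) x d cx+d≡0 = cong (frac _) (double-neg (num w) (den w) x)
  where
  double-neg : ∀ N D x → - + 1 * N + - (- + 1 * x) * D ≡ - + 1 * N + x * D
  double-neg = solve-∀
-- g = - rot x
... | inj₁ (refl , refl) rewrite isolate-d (+ 1) x d cx+d≡0 =
  trans (cong₂ frac (negate-num (num w) (den w)) (negate-den (num w) (den w) x)) (frac-neg _ _)
  where
  negate-num : ∀ N D → + 0 * N + - + 1 * D ≡ - (+ 0 * N + + 1 * D)
  negate-num = solve-∀
  negate-den : ∀ N D x → + 1 * N + - (+ 1 * x) * D ≡ - (- + 1 * N + x * D)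
  negate-den = solve-∀

det≡1⇒>∞ : ∀ v w → + 0 ℤ.< den w → num v * den w - num w * den v ≡ + 1 → v >∞ w
det≡1⇒>∞ ∞       ∞       (+<+ ()) _
det≡1⇒>∞ (fin p) ∞       (+<+ ()) _
det≡1⇒>∞ ∞       (fin q) _        _ = ∞>fin
det≡1⇒>∞ (fin p) (fin q) _        det≡1 = fin>fin (ℚ.*<* (ℤP.suc[i]≤j⇒i<j (ℤP.≤-reflexive (sym after))))
  where
  x = ↥ p * ↧ q
  y = ↥ q * ↧ p
  rearrange : ∀ x y → x ≡ + 1 + y + (x - y - + 1)
  rearrange = solve-∀
  after : x ≡ ℤ.suc y
  after = trans (rearrange x y) (trans (cong (λ z → + 1 + y + (z - + 1)) det≡1) (ℤP.+-identityʳ _))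

det≡1⇒edge : ∀ v w → num v * den w - num w * den v ≡ + 1 → FareyEdge v w
det≡1⇒edge v w det≡1 = cong ℤ.∣_∣ det≡1

-- A frieze of width n-3, n = 3 + m, in band coordinates: e i t is the entry
-- c_{i,i-2+t} of row i, the band being 0 ≤ t ≤ n.
record BandFrieze (m : ℕ) (e : ℤ → ℕ → ℤ) : Set where
  field
    left-zero  : ∀ i → e i 0 ≡ + 0
    left-one   : ∀ i → e i 1 ≡ + 1
    right-one  : ∀ i → e i (2 ℕ.+ m) ≡ + 1
    right-zero : ∀ i → e i (3 ℕ.+ m) ≡ + 0
    unimodular : ∀ i t → t ≤ suc m →
                 e i (suc t) * e (i + + 1) (suc t) - e i (suc (suc t)) * e (i + + 1) t ≡ + 1
    positive   : ∀ i t → t ≤ suc m → + 0 ℤ.< e i (suc t)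

shift-BandFrieze : ∀ {m e} s → BandFrieze m e → BandFrieze m (λ i → e (i + s))
shift-BandFrieze {m} {e} s B = record
  { left-zero  = λ i → left-zero (i + s)
  ; left-one   = λ i → left-one (i + s)
  ; right-one  = λ i → right-one (i + s)
  ; right-zero = λ i → right-zero (i + s)
  ; unimodular = λ i t t≤ →
      subst (λ r → e (i + s) (suc t) * e r (suc t) - e (i + s) (suc (suc t)) * e r t ≡ + 1)
            (next-row i s) (unimodular (i + s) t t≤)
  ; positive   = λ i → positive (i + s)
  }
  where
  open BandFrieze B
  next-row : ∀ i s → i + s + + 1 ≡ i + + 1 + s
  next-row = solve-∀

rowRatios : (ℤ → ℕ → ℤ) → ℤ → ℕ → ℚ∞
rowRatios e k j = frac (e k (suc j)) (e (k + + 1) j)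

private
  cancel-pos : ∀ a x y → + 0 ℤ.< a → a * x ≡ a * y → x ≡ y
  cancel-pos +[1+ k ] x y _ = ℤP.*-cancelˡ-≡ +[1+ k ] x y
  cancel-pos (+ zero) x y (+<+ ())

  recurrence-step : ∀ E F G E₁ F₁ G₁ a → E * F₁ - E₁ * F ≡ + 1 → F * G₁ - F₁ * G ≡ + 1 →
                    G + E ≡ a * F → F * (G₁ + E₁) ≡ F * (a * F₁)
  recurrence-step E F G E₁ F₁ G₁ a det₁ det₂ rec = begin
      F * (G₁ + E₁)                                          ≡⟨ expand E F G E₁ F₁ G₁ ⟩
      (F * G₁ - F₁ * G) - (E * F₁ - E₁ * F) + F₁ * (G + E)   ≡⟨ cong₂ (λ x y → x - y + F₁ * (G + E)) det₂ det₁ ⟩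
      + 1 - + 1 + F₁ * (G + E)                               ≡⟨ cong (λ z → + 1 - + 1 + F₁ * z) rec ⟩
      + 1 - + 1 + F₁ * (a * F)                               ≡⟨ collect F F₁ a ⟩
      F * (a * F₁)                                           ∎
    where
    open ≡-Reasoning
    expand : ∀ E F G E₁ F₁ G₁ → F * (G₁ + E₁) ≡ (F * G₁ - F₁ * G) - (E * F₁ - E₁ * F) + F₁ * (G + E)
    expand = solve-∀
    collect : ∀ F F₁ a → + 1 - + 1 + F₁ * (a * F) ≡ F * (a * F₁)
    collect = solve-∀

  solve-first : ∀ G E a F → G + E ≡ a * F → G ≡ a * F - E
  solve-first G E a F h = trans (isolate G E) (cong (_- E) h)
    where
    isolate : ∀ G E → G ≡ G + E - E
    isolate = solve-∀

  solve-second : ∀ G E a F → G + E ≡ a * F → E ≡ a * F - G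
  solve-second G E a F h = trans (isolate G E) (cong (_- G) h)
    where
    isolate : ∀ G E → E ≡ G + E - G
    isolate = solve-∀

  beyond-range : ∀ {m t} → ¬ t ≤ suc m → t ≤ 3 ℕ.+ m → t ≡ 2 ℕ.+ m ⊎ t ≡ 3 ℕ.+ m
  beyond-range {m} {t} t≰ t≤ with ℕP.m≤n⇒m<n∨m≡n t≤
  ... | inj₂ t≡n = inj₂ t≡n
  ... | inj₁ t<n = inj₁ (ℕP.≤-antisym (ℕ.s≤s⁻¹ t<n) (ℕP.≰⇒> t≰))

same-cyc : ∀ {n v w} → SameSeq n v w → CycEq n v w
same-cyc v≡w = EqClosure.return (inj₁ v≡w)

rotate-cyc : ∀ {n v w} → Rotate n v w → CycEq n v w
rotate-cyc v↻w = EqClosure.return (inj₂ v↻w)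

module BandFacts {m : ℕ} {e : ℤ → ℕ → ℤ} (B : BandFrieze m e) where
  open BandFrieze B

  private
    n : ℕ
    n = 3 ℕ.+ m

  recurrence : ∀ k t → t ≤ suc m → e (k + + 1 + + 1) t + e k (suc (suc t)) ≡ e k 2 * e (k + + 1) (suc t)
  recurrence k zero _ = begin
      e (k + + 1 + + 1) 0 + e k 2  ≡⟨ cong (_+ e k 2) (left-zero _) ⟩
      + 0 + e k 2                  ≡⟨ ℤP.+-identityˡ _ ⟩
      e k 2                        ≡⟨ ℤP.*-identityʳ _ ⟨
      e k 2 * + 1                  ≡⟨ cong (e k 2 *_) (left-one _) ⟨
      e k 2 * e (k + + 1) 1        ∎
    where open ≡-Reasoning
  recurrence k (suc t) t+1≤m+1 =
    cancel-pos (e (k + + 1) (suc t)) _ _ (positive (k + + 1) t t≤m+1)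
      (recurrence-step _ _ _ _ _ _ (e k 2)
        (unimodular k (suc t) t+1≤m+1) (unimodular (k + + 1) t t≤m+1) (recurrence k t t≤m+1))
    where
    t≤m+1 = ℕP.m≤n⇒m≤1+n (ℕ.s≤s⁻¹ t+1≤m+1)

  -- c_{k,k} = c_{k+2,k+n-2}: the recurrence at the end of the band.
  diagonal-glide : ∀ k → e k 2 ≡ e (k + + 1 + + 1) (suc m)
  diagonal-glide k = begin
      e k 2                                       ≡⟨ ℤP.*-identityʳ _ ⟨
      e k 2 * + 1                                 ≡⟨ cong (e k 2 *_) (right-one _) ⟨
      e k 2 * e (k + + 1) (2 ℕ.+ m)               ≡⟨ recurrence k (suc m) ℕP.≤-refl ⟨
      e (k + + 1 + + 1) (suc m) + e k (3 ℕ.+ m)   ≡⟨ cong (λ z → e (k + + 1 + + 1) (suc m) + z) (right-zero k) ⟩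
      e (k + + 1 + + 1) (suc m) + + 0             ≡⟨ ℤP.+-identityʳ _ ⟩
      e (k + + 1 + + 1) (suc m)                   ∎
    where open ≡-Reasoning

  row-coprime : ∀ k j → j < n → Coprime (e k (suc j)) (e (k + + 1) j)
  row-coprime k j j<n with j ℕ.≤? suc m
  ... | yes j≤m+1 = unimodular⇒coprime _ _ (e (k + + 1) (suc j)) (e k (suc (suc j))) (unimodular k j j≤m+1)
  ... | no  j≰m+1 rewrite ℕP.≤-antisym (ℕ.s≤s⁻¹ j<n) (ℕP.≰⇒> j≰m+1) =
    + 0 , + 1 , trans (only-second (e k (3 ℕ.+ m)) _) (right-one (k + + 1))
    where
    only-second : ∀ p q → + 0 * p + + 1 * q ≡ q
    only-second = solve-∀

  rowRatios-num-den : ∀ k j → j < n → num (rowRatios e k j) ≡ e k (suc j) × den (rowRatios e k j) ≡ e (k + + 1) j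
  rowRatios-num-den k zero    _ rewrite left-one k | left-zero (k + + 1) = refl , refl
  rowRatios-num-den k (suc j) j<n =
    frac-normal _ _ (row-coprime k (suc j) j<n) (ℤP.<⇒≤ den>0)
      (λ den≡0 → contradiction (subst (+ 0 ℤ.<_) den≡0 den>0) (ℤP.<-irrefl refl))
    where
    den>0 = positive (k + + 1) j (ℕ.s≤s⁻¹ (ℕ.s≤s⁻¹ j<n))

  rowRatios-first : ∀ k → rowRatios e k 0 ≡ ∞
  rowRatios-first k = cong (frac (e k 1)) (left-zero (k + + 1))

  rowRatios-last : ∀ k → rowRatios e k (2 ℕ.+ m) ≡ fin 0ℚ
  rowRatios-last k = cong₂ frac (right-zero k) (right-one (k + + 1))

  consecutive-det : ∀ k j → suc j < n →
    num (rowRatios e k j) * den (rowRatios e k (suc j)) - num (rowRatios e k (suc j)) * den (rowRatios e k j) ≡ + 1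
  consecutive-det k j j+1<n
    rewrite proj₁ (rowRatios-num-den k j (ℕP.<-trans (ℕP.n<1+n j) j+1<n))
          | proj₂ (rowRatios-num-den k j (ℕP.<-trans (ℕP.n<1+n j) j+1<n))
          | proj₁ (rowRatios-num-den k (suc j) j+1<n)
          | proj₂ (rowRatios-num-den k (suc j) j+1<n) = unimodular k j (ℕ.s≤s⁻¹ (ℕ.s≤s⁻¹ j+1<n))

  rowRatios-polygon : ∀ k → NormFareyPolygon n (rowRatios e k)
  rowRatios-polygon k = record
    { polygon = record
      { top       = ∞≥
      ; decr      = λ j j+1<n → det≡1⇒>∞ (rowRatios e k j) (rowRatios e k (suc j)) (den>0 j j+1<n) (consecutive-det k j j+1<n)
      ; bottom    = subst (_≥∞ fin 0ℚ) (sym (rowRatios-last k)) (fin≥fin (ℚP.≤-refl {0ℚ}))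
      ; edges     = λ j j+1<n → det≡1⇒edge (rowRatios e k j) (rowRatios e k (suc j)) (consecutive-det k j j+1<n)
      ; closeEdge = subst₂ FareyEdge (sym (rowRatios-last k)) (sym (rowRatios-first k)) refl
      }
    ; first = rowRatios-first k
    ; last  = rowRatios-last k
    }
    where
    den>0 : ∀ j → suc j < n → + 0 ℤ.< den (rowRatios e k (suc j))
    den>0 j j+1<n = subst (+ 0 ℤ.<_) (sym (proj₂ (rowRatios-num-den k (suc j) j+1<n)))
                          (positive (k + + 1) j (ℕ.s≤s⁻¹ (ℕ.s≤s⁻¹ j+1<n)))

  rowRatios-rot : ∀ k j → suc j < n → rowRatios e (k + + 1) j ≡ act (rot (e k 2)) (rowRatios e k (suc j))
  rowRatios-rot k j j+1<n = begin
      frac q (e (k + + 1 + + 1) j)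
        ≡⟨ cong (frac q) (solve-first (e (k + + 1 + + 1) j) p x q (recurrence k j (ℕ.s≤s⁻¹ (ℕ.s≤s⁻¹ j+1<n)))) ⟩
      frac q (x * q - p)                             ≡⟨ cong₂ frac (only-second p q) (rearrange x p q) ⟨
      frac (+ 0 * p + + 1 * q) (- + 1 * p + x * q)   ≡⟨ act-frac (rot x) p q (row-coprime k (suc j) j+1<n) ⟨
      act (rot x) (frac p q)                         ∎
    where
    open ≡-Reasoning
    x = e k 2
    p = e k (suc (suc j))
    q = e (k + + 1) (suc j)
    only-second : ∀ p q → + 0 * p + + 1 * q ≡ q
    only-second = solve-∀
    rearrange : ∀ x p q → - + 1 * p + x * q ≡ x * q - p
    rearrange = solve-∀

  rotation-step : ∀ k → Rotate n (rowRatios e k) (rowRatios e (k + + 1))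
  rotation-step k =
    rowRatios-polygon k , rowRatios-polygon (k + + 1) , rot x ,
    trans (cong (λ z → act (rot x) (frac x z)) (left-one (k + + 1))) (rot-x x) ,
    first↦0 , rowRatios-rot k , trans (rowRatios-last (k + + 1)) (sym first↦0)
    where
    x = e k 2
    first↦0 : act (rot x) (rowRatios e k 0) ≡ fin 0ℚ
    first↦0 = trans (cong (act (rot x)) (rowRatios-first k)) (rot-∞ x)

  -- Conversely every cyclic move starting at the ratios of rows k, k+1 leads to
  -- the ratios of rows k+1, k+2, since the moving matrix must be ± rot c_{k,k}.
  rotation-unique : ∀ k v w → SameSeq n v (rowRatios e k) → Rotate n v w → SameSeq n w (rowRatios e (k + + 1))
  rotation-unique k v w v≡ (_ , _ , g , v₁↦∞ , v₀↦0 , w-inner , w-last) j j<n with suc j ℕ.<? n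
  ... | yes j+1<n = begin
      w j                                          ≡⟨ w-inner j j+1<n ⟩
      act g (v (suc j))                            ≡⟨ cong (act g) (v≡ (suc j) j+1<n) ⟩
      act g (rowRatios e k (suc j))                ≡⟨ act-rot-unique g x a≡0 cx+d≡0 _ ⟩
      act (rot x) (rowRatios e k (suc j))          ≡⟨ rowRatios-rot k j j+1<n ⟨
      rowRatios e (k + + 1) j                      ∎
    where
    open ≡-Reasoning
    open SL2 g using (a; b; c; d)
    x = e k 2
    -- g sends v₀ = ∞ to 0, so a = 0
    a≡0 : a ≡ + 0
    a≡0 = trans (sym (simplify a b))
                (frac≡0⇒num≡0 _ _ (trans (cong (act g) (sym (trans (v≡ 0 z<s) (rowRatios-first k)))) v₀↦0))
      where
      simplify : ∀ a b → a * + 1 + b * + 0 ≡ a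
      simplify = solve-∀
    -- g sends v₁ = x/1 to ∞, so c x + d = 0
    v₁≡x : v 1 ≡ frac x (+ 1)
    v₁≡x = trans (v≡ 1 (s≤s (s≤s z≤n))) (cong (frac x) (left-one (k + + 1)))
    cx+d≡0 : c * x + d ≡ + 0
    cx+d≡0 = trans (cong (λ z → c * x + z) (sym (ℤP.*-identityʳ d)))
               (frac≡∞⇒den≡0 _ _ (trans (sym (act-frac g x (+ 1) (+ 0 , + 1 , refl))) (trans (cong (act g) (sym v₁≡x)) v₁↦∞)))
  ... | no j+1≮n rewrite ℕP.≤-antisym (ℕ.s≤s⁻¹ j<n) (ℕ.s≤s⁻¹ (ℕP.≮⇒≥ j+1≮n)) =
    trans w-last (trans v₀↦0 (sym (rowRatios-last (k + + 1))))

  rowRatios-cyclic : ∀ k k' → CycEq n (rowRatios e k) (rowRatios e k')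
  rowRatios-cyclic k = ℤ-induction (λ i → CycEq n (rowRatios e k) (rowRatios e i)) k ε
    (λ i k~i   → EqClosure.transitive (CycStep n) k~i (rotate-cyc (rotation-step i)))
    (λ i k~i+1 → EqClosure.transitive (CycStep n) k~i+1 (EqClosure.symmetric (CycStep n) (rotate-cyc (rotation-step i))))

-- A band frieze is determined by two consecutive rows: the diagonal recurrence
-- computes row k+2 from rows k, k+1, and together with the glide
-- c_{k,k} = c_{k+2,k+n-2} it computes row k from rows k+1, k+2.
module Uniqueness {m : ℕ} {e e' : ℤ → ℕ → ℤ} (B : BandFrieze m e) (B' : BandFrieze m e') where
  open BandFrieze

  private
    n : ℕ
    n = 3 ℕ.+ m

    next-row : ∀ {e} → BandFrieze m e → ∀ k t → t ≤ suc m →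
               e (k + + 1 + + 1) t ≡ e k 2 * e (k + + 1) (suc t) - e k (suc (suc t))
    next-row {e} B k t t≤m+1 =
      solve-first (e (k + + 1 + + 1) t) (e k (suc (suc t))) (e k 2) (e (k + + 1) (suc t)) (BandFacts.recurrence B k t t≤m+1)

    previous-row : ∀ {e} → BandFrieze m e → ∀ k t → t ≤ suc m →
                   e k (suc (suc t)) ≡ e (k + + 1 + + 1) (suc m) * e (k + + 1) (suc t) - e (k + + 1 + + 1) t
    previous-row {e} B k t t≤m+1 =
      trans (solve-second (e (k + + 1 + + 1) t) (e k (suc (suc t))) (e k 2) (e (k + + 1) (suc t)) (BandFacts.recurrence B k t t≤m+1))
            (cong (λ x → x * e (k + + 1) (suc t) - e (k + + 1 + + 1) t) (BandFacts.diagonal-glide B k))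

    2≤n : 2 ≤ n
    2≤n = s≤s (s≤s z≤n)

    m+1≤n : suc m ≤ n
    m+1≤n = ℕP.m≤n⇒m≤1+n (ℕP.n≤1+n (suc m))

    t+1≤n : ∀ {t} → t ≤ suc m → suc t ≤ n
    t+1≤n t≤m+1 = ℕP.m≤n⇒m≤1+n (s≤s t≤m+1)

  RowsAgree : ℤ → Set
  RowsAgree i = ∀ t → t ≤ n → e' i t ≡ e i t

  agree-up : ∀ k → RowsAgree k → RowsAgree (k + + 1) → RowsAgree (k + + 1 + + 1)
  agree-up k r₀ r₁ t t≤n with t ℕ.≤? suc m
  ... | yes t≤m+1 = begin
      e' (k + + 1 + + 1) t                               ≡⟨ next-row B' k t t≤m+1 ⟩
      e' k 2 * e' (k + + 1) (suc t) - e' k (suc (suc t))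
        ≡⟨ cong₂ _-_ (cong₂ _*_ (r₀ 2 2≤n) (r₁ (suc t) (t+1≤n t≤m+1))) (r₀ (suc (suc t)) (s≤s (s≤s t≤m+1))) ⟩
      e k 2 * e (k + + 1) (suc t) - e k (suc (suc t))    ≡⟨ next-row B k t t≤m+1 ⟨
      e (k + + 1 + + 1) t                                ∎
    where open ≡-Reasoning
  ... | no t≰m+1 with beyond-range t≰m+1 t≤n
  ...   | inj₁ refl = trans (right-one B' _) (sym (right-one B _))
  ...   | inj₂ refl = trans (right-zero B' _) (sym (right-zero B _))

  agree-down : ∀ k → RowsAgree (k + + 1) → RowsAgree (k + + 1 + + 1) → RowsAgree k
  agree-down k r₁ r₂ zero          _ = trans (left-zero B' k) (sym (left-zero B k))
  agree-down k r₁ r₂ (suc zero)    _ = trans (left-one B' k) (sym (left-one B k))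
  agree-down k r₁ r₂ (suc (suc t)) t+2≤n = begin
      e' k (suc (suc t))                                                   ≡⟨ previous-row B' k t t≤m+1 ⟩
      e' (k + + 1 + + 1) (suc m) * e' (k + + 1) (suc t) - e' (k + + 1 + + 1) t
        ≡⟨ cong₂ _-_ (cong₂ _*_ (r₂ (suc m) m+1≤n) (r₁ (suc t) (t+1≤n t≤m+1))) (r₂ t (ℕP.<⇒≤ (t+1≤n t≤m+1))) ⟩
      e (k + + 1 + + 1) (suc m) * e (k + + 1) (suc t) - e (k + + 1 + + 1) t   ≡⟨ previous-row B k t t≤m+1 ⟨
      e k (suc (suc t))                                                    ∎
    where
    open ≡-Reasoning
    t≤m+1 = ℕ.s≤s⁻¹ (ℕ.s≤s⁻¹ t+2≤n)

  rows-determine : ∀ k → RowsAgree k → RowsAgree (k + + 1) → ∀ i → RowsAgree i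
  rows-determine k r₀ r₁ i = proj₁ (ℤ-induction (λ i → RowsAgree i × RowsAgree (i + + 1)) k (r₀ , r₁)
    (λ i (rᵢ , rᵢ₊₁) → rᵢ₊₁ , agree-up i rᵢ rᵢ₊₁)
    (λ i (rᵢ₊₁ , rᵢ₊₂) → agree-down i rᵢ₊₁ rᵢ₊₂ , rᵢ₊₁) i)

-- Equal row ratios force equal pairs of rows, so by uniqueness the two band
-- friezes differ by the corresponding shift of rows.
rowRatios-injective : ∀ {m e e'} → BandFrieze m e → BandFrieze m e' → ∀ k k' →
  SameSeq (3 ℕ.+ m) (rowRatios e k) (rowRatios e' k') → ∀ i t → t ≤ 3 ℕ.+ m → e' i t ≡ e (i + (k - k')) t
rowRatios-injective {m} {e} {e'} B B' k k' same = rows-determine k' row₀ row₁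
  where
  open Uniqueness (shift-BandFrieze (k - k') B) B'
  module F = BandFacts B
  module F' = BandFacts B'
  open BandFrieze

  back-to-k : k' + (k - k') ≡ k
  back-to-k = shift-back k' k
    where
    shift-back : ∀ k' k → k' + (k - k') ≡ k
    shift-back = solve-∀

  back-to-k+1 : k' + + 1 + (k - k') ≡ k + + 1
  back-to-k+1 = shift-back k' k
    where
    shift-back : ∀ k' k → k' + + 1 + (k - k') ≡ k + + 1
    shift-back = solve-∀

  row₀ : RowsAgree k'
  row₀ zero    _     = trans (left-zero B' k') (sym (left-zero B _))
  row₀ (suc j) j+1≤n = begin
      e' k' (suc j)               ≡⟨ proj₁ (F'.rowRatios-num-den k' j j+1≤n) ⟨
      num (rowRatios e' k' j)     ≡⟨ cong num (same j j+1≤n) ⟨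
      num (rowRatios e k j)       ≡⟨ proj₁ (F.rowRatios-num-den k j j+1≤n) ⟩
      e k (suc j)                 ≡⟨ cong (λ r → e r (suc j)) back-to-k ⟨
      e (k' + (k - k')) (suc j)   ∎
    where open ≡-Reasoning

  row₁ : RowsAgree (k' + + 1)
  row₁ t t≤n with ℕP.m≤n⇒m<n∨m≡n t≤n
  ... | inj₂ refl = trans (right-zero B' _) (sym (right-zero B _))
  ... | inj₁ t<n = begin
      e' (k' + + 1) t                 ≡⟨ proj₂ (F'.rowRatios-num-den k' t t<n) ⟨
      den (rowRatios e' k' t)         ≡⟨ cong den (same t t<n) ⟨
      den (rowRatios e k t)           ≡⟨ proj₂ (F.rowRatios-num-den k t t<n) ⟩
      e (k + + 1) t                   ≡⟨ cong (λ r → e r t) back-to-k+1 ⟨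
      e (k' + + 1 + (k - k')) t       ∎
    where open ≡-Reasoning

shifted-rowRatios : ∀ {n e e'} s → (∀ i t → t ≤ n → e' i t ≡ e (i + s) t) →
                    ∀ k → SameSeq n (rowRatios e' k) (rowRatios e (k + s))
shifted-rowRatios {e = e} s shift k j j<n =
  cong₂ frac (shift k (suc j) j<n) (trans (shift (k + + 1) j (ℕP.<⇒≤ j<n)) (cong (λ r → e r j) (next-row k s)))
  where
  next-row : ∀ k s → k + + 1 + s ≡ k + s + + 1
  next-row = solve-∀

band : (ℤ → ℤ → ℤ) → ℤ → ℕ → ℤ
band c i t = c i (i - + 2 + + t)

ratios-rowRatios : ∀ {n} c k → SameSeq n (ratios c k) (rowRatios (band c) k)
ratios-rowRatios c k j _ = cong₂ frac (cong (c k) (row-k k (+ j))) (cong (c (k + + 1)) (row-k+1 k (+ j)))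
  where
  row-k : ∀ k J → k - + 1 + J ≡ k - + 2 + (+ 1 + J)
  row-k = solve-∀
  row-k+1 : ∀ k J → k - + 1 + J ≡ k + + 1 - + 2 + J
  row-k+1 = solve-∀

module BandIndex (n : ℕ) where

  inBand : ∀ i t {j} → t ≤ n → j ≡ i - + 2 + + t → InBand n i j
  inBand i t t≤n refl =
    ℤP.i≤i+j (i - + 2) (+ t) , subst (i - + 2 + + t ℤ.≤_) (regroup i (+ n)) (ℤP.+-monoʳ-≤ (i - + 2) (+≤+ t≤n))
    where
    regroup : ∀ i N → i - + 2 + N ≡ i + N - + 2
    regroup = solve-∀

  band-position : ∀ i j → InBand n i j → Σ ℕ λ t → t ≤ n × j ≡ i - + 2 + + t
  band-position i j (lo , hi) with ≤⇒offset lo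
  ... | t , refl = t , offset-cancel (i - + 2) t n (subst (i - + 2 + + t ℤ.≤_) (regroup i (+ n)) hi) , refl
    where
    regroup : ∀ i N → i + N - + 2 ≡ i - + 2 + N
    regroup = solve-∀

  private
    shift-position : ∀ i s T → i - + 2 + T + s ≡ i + s - + 2 + T
    shift-position = solve-∀

  shiftEq⇒band : ∀ {c c'} → ShiftEq n c c' → Σ ℤ λ s → ∀ i t → t ≤ n → band c' i t ≡ band c (i + s) t
  shiftEq⇒band {c} (s , c'≡c) =
    s , λ i t t≤n → trans (c'≡c i _ (inBand i t t≤n refl)) (cong (c (i + s)) (shift-position i s (+ t)))

  band⇒shiftEq : ∀ {c c'} s → (∀ i t → t ≤ n → band c' i t ≡ band c (i + s) t) → ShiftEq n c c'
  band⇒shiftEq {c} {c'} s c'≡c = s , λ i j j∈band →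
    let t , t≤n , j≡ = band-position i j j∈band in begin
      c' i j                   ≡⟨ cong (c' i) j≡ ⟩
      band c' i t              ≡⟨ c'≡c i t t≤n ⟩
      band c (i + s) t         ≡⟨ cong (c (i + s)) (shift-position i s (+ t)) ⟨
      c (i + s) (i - + 2 + + t + s) ≡⟨ cong (λ x → c (i + s) (x + s)) j≡ ⟨
      c (i + s) (j + s)        ∎
    where open ≡-Reasoning

module FriezeBand {m : ℕ} {c : ℤ → ℤ → ℤ} (F : Frieze (3 ℕ.+ m) c) where
  open Frieze F
  open BandIndex (3 ℕ.+ m)

  private
    band-one-left : ∀ i → band c i 1 ≡ + 1
    band-one-left i = trans (cong (c i) (regroup i)) (oneˡ i)
      where
      regroup : ∀ i → i - + 2 + + 1 ≡ i - + 1
      regroup = solve-∀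

    band-one-right : ∀ i → band c i (2 ℕ.+ m) ≡ + 1
    band-one-right i = trans (cong (c i) (regroup i (+ m))) (oneʳ i)
      where
      regroup : ∀ i M → i - + 2 + (+ 2 + M) ≡ i + (+ 3 + M) - + 3
      regroup = solve-∀

    unimodular-band : ∀ i t → t ≤ suc m →
      band c i (suc t) * band c (i + + 1) (suc t) - band c i (suc (suc t)) * band c (i + + 1) t ≡ + 1
    unimodular-band i t t≤m+1 =
      trans (columns (next-row-next-col i (+ t)) (same-row-next-col i (+ t)) (next-row-same-col i (+ t)))
        (unimodular i j
          (inBand i (suc t) (t+1≤n) refl)
          (inBand i (suc (suc t)) (s≤s (s≤s t≤m+1)) (same-row-next-col i (+ t)))
          (inBand (i + + 1) t (ℕP.<⇒≤ t+1≤n) (next-row-same-col i (+ t)))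
          (inBand (i + + 1) (suc t) t+1≤n (next-row-next-col i (+ t))))
      where
      j = i - + 2 + + suc t
      t+1≤n = ℕP.m≤n⇒m≤1+n (s≤s t≤m+1)
      next-row-next-col : ∀ i T → i - + 2 + (+ 1 + T) + + 1 ≡ i + + 1 - + 2 + (+ 1 + T)
      next-row-next-col = solve-∀
      same-row-next-col : ∀ i T → i - + 2 + (+ 1 + T) + + 1 ≡ i - + 2 + (+ 1 + (+ 1 + T))
      same-row-next-col = solve-∀
      next-row-same-col : ∀ i T → i - + 2 + (+ 1 + T) ≡ i + + 1 - + 2 + T
      next-row-same-col = solve-∀
      columns : ∀ {x x' y y' z z'} → x ≡ x' → y ≡ y' → z ≡ z' →
                c i j * c (i + + 1) x' - c i y' * c (i + + 1) z' ≡ c i j * c (i + + 1) x - c i y * c (i + + 1) z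
      columns refl refl refl = refl

    -- Interior positions 2 ≤ t ≤ n-2 are the entries c_{i,i+t-2} covered by positivity.
    positive-interior : ∀ i t → t < m → + 0 ℤ.< band c i (suc (suc t))
    positive-interior i t t<m = subst (+ 0 ℤ.<_) (cong (c i) (regroup i (+ t)))
      (positive i (i + + t) (ℤP.i≤i+j i (+ t))
        (subst (i + + t ℤ.≤_) (sym (trans (cong (λ M → i + (+ 3 + M) - + 4) m≡) (expand i (+ t) (+ d))))
               (ℤP.i≤i+j (i + + t) (+ d))))
      where
      d = m ℕ.∸ suc t
      m≡ : + m ≡ + 1 + (+ t + + d)
      m≡ = cong +_ (sym (ℕP.m+[n∸m]≡n t<m))
      regroup : ∀ i T → i + T ≡ i - + 2 + (+ 2 + T)
      regroup = solve-∀
      expand : ∀ i T D → i + (+ 3 + (+ 1 + (T + D))) - + 4 ≡ i + T + D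
      expand = solve-∀

    positive-band : ∀ i t → t ≤ suc m → + 0 ℤ.< band c i (suc t)
    positive-band i zero _ = subst (+ 0 ℤ.<_) (sym (band-one-left i)) (+<+ z<s)
    positive-band i (suc t) t+1≤m+1 with ℕP.m≤n⇒m<n∨m≡n (ℕ.s≤s⁻¹ t+1≤m+1)
    ... | inj₁ t<m = positive-interior i t t<m
    ... | inj₂ refl = subst (+ 0 ℤ.<_) (sym (band-one-right i)) (+<+ z<s)

  band-isBandFrieze : BandFrieze m (band c)
  band-isBandFrieze = record
    { left-zero  = λ i → trans (cong (c i) (ℤP.+-identityʳ (i - + 2))) (zeroˡ i)
    ; left-one   = band-one-left
    ; right-one  = band-one-right
    ; right-zero = λ i → trans (cong (c i) (regroup i (+ m))) (zeroʳ i)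
    ; unimodular = unimodular-band
    ; positive   = positive-band
    }
    where
    regroup : ∀ i M → i - + 2 + (+ 3 + M) ≡ i + (+ 3 + M) - + 2
    regroup = solve-∀

>∞⇒det>0 : ∀ v w → v >∞ w → + 0 ℤ.< num v * den w - num w * den v
>∞⇒det>0 ∞ (fin (mkℚ a d _)) ∞>fin = subst (+ 0 ℤ.<_) (sym (simplify a (+ suc d))) (+<+ z<s)
  where
  simplify : ∀ a D → + 1 * D - a * + 0 ≡ D
  simplify = solve-∀
>∞⇒det>0 (fin p) (fin q) (fin>fin (ℚ.*<* q<p)) =
  subst (ℤ._< ↥ p * ↧ q - ↥ q * ↧ p) (ℤP.+-inverseʳ (↥ q * ↧ p)) (ℤP.+-monoˡ-< (- (↥ q * ↧ p)) q<p)

module PolygonFrieze (m : ℕ) (v : ℕ → ℚ∞) (P : NormFareyPolygon (3 ℕ.+ m) v) where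
  open NormFareyPolygon P
  open FareyPolygon polygon

  private
    n : ℕ
    n = 3 ℕ.+ m

  vertex : ℕ → ℤ²
  vertex j = num (v j) , den (v j)

  vertices-decreasing : ∀ p q → p < q → q < n → v p >∞ v q
  vertices-decreasing p (suc q) p<q+1 q+1<n with ℕP.m≤n⇒m<n∨m≡n (ℕ.s≤s⁻¹ p<q+1)
  ... | inj₂ refl = decr p q+1<n
  ... | inj₁ p<q  = >∞-trans (vertices-decreasing p q p<q (ℕP.<-trans (ℕP.n<1+n q) q+1<n)) (decr q q+1<n)
    where
    >∞-trans : ∀ {x y z} → x >∞ y → y >∞ z → x >∞ z
    >∞-trans ∞>fin        (fin>fin _)  = ∞>fin
    >∞-trans (fin>fin y<x) (fin>fin z<y) = fin>fin (ℚP.<-trans z<y y<x)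

  det-vertices : ∀ p q → p < q → q < n → + 0 ℤ.< det (vertex p) (vertex q)
  det-vertices p q p<q q<n = >∞⇒det>0 (v p) (v q) (vertices-decreasing p q p<q q<n)

  det-consecutive : ∀ j → suc j < n → det (vertex j) (vertex (suc j)) ≡ + 1
  det-consecutive j j+1<n = positive-unit (det-vertices j (suc j) (ℕP.n<1+n j) j+1<n) (edges j j+1<n)
    where
    positive-unit : ∀ {x} → + 0 ℤ.< x → ℤ.∣ x ∣ ≡ 1 → x ≡ + 1
    positive-unit {+ suc zero} _ _ = refl

  open Antiperiodic neg neg-involutive (2 ℕ.+ m) vertex renaming (extend to U; extend-base to U-base; extend-shift to U-shift)

  private
    module Periodic = Translation n (λ x y → det (U x) (U y))
                                    (λ x y → trans (cong₂ det (U-shift x) (U-shift y)) (det-neg-neg (U x) (U y)))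

    U-wrap : ∀ r → r < n → U (+ (r ℕ.+ n)) ≡ neg (vertex r)
    U-wrap r r<n = trans (U-shift (+ r)) (cong neg (U-base r r<n))

  det-positive : ∀ x d → 1 ≤ d → d < n → + 0 ℤ.< det (U x) (U (x + + d))
  det-positive x d 1≤d d<n =
    subst (+ 0 ℤ.<_) (sym (Periodic.reduce x d)) (base (x ℤD.%ℕ n) (ℤD.n%ℕd<d x n))
    where
    base : ∀ r → r < n → + 0 ℤ.< det (U (+ r)) (U (+ (r ℕ.+ d)))
    base r r<n with r ℕ.+ d ℕ.<? n
    ... | yes r+d<n rewrite U-base r r<n | U-base (r ℕ.+ d) r+d<n =
      det-vertices r (r ℕ.+ d) (subst (_≤ r ℕ.+ d) (ℕP.+-comm r 1) (ℕP.+-monoʳ-≤ r 1≤d)) r+d<n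
    ... | no r+d≮n = subst (λ z → + 0 ℤ.< det (U (+ r)) (U (+ z))) (ℕP.m∸n+n≡m (ℕP.≮⇒≥ r+d≮n)) wrapped
      where
      w = r ℕ.+ d ℕ.∸ n
      w<r : w < r
      w<r = ℕP.+-cancelʳ-< n w r (subst (ℕ._< r ℕ.+ n) (sym (ℕP.m∸n+n≡m (ℕP.≮⇒≥ r+d≮n))) (ℕP.+-monoʳ-< r d<n))
      wrapped : + 0 ℤ.< det (U (+ r)) (U (+ (w ℕ.+ n)))
      wrapped rewrite U-base r r<n | U-wrap w (ℕP.<-trans w<r r<n) =
        subst (+ 0 ℤ.<_) (sym (det-negʳ (vertex r) (vertex w))) (det-vertices w r w<r r<n)

  -- Consecutive vectors have determinant 1; across the wrap this is v_{n-1} = 0, v_0 = ∞.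
  det-adjacent : ∀ x → det (U x) (U (x + + 1)) ≡ + 1
  det-adjacent x = trans (Periodic.reduce x 1) (base (x ℤD.%ℕ n) (ℤD.n%ℕd<d x n))
    where
    base : ∀ r → r < n → det (U (+ r)) (U (+ (r ℕ.+ 1))) ≡ + 1
    base r r<n rewrite ℕP.+-comm r 1 with suc r ℕ.<? n
    ... | yes r+1<n rewrite U-base r r<n | U-base (suc r) r+1<n = det-consecutive r r+1<n
    ... | no r+1≮n rewrite ℕP.≤-antisym (ℕ.s≤s⁻¹ r<n) (ℕ.s≤s⁻¹ (ℕP.≮⇒≥ r+1≮n)) | U-base (2 ℕ.+ m) (ℕP.n<1+n _) | U-wrap 0 z<s =
      trans (det-negʳ (vertex (2 ℕ.+ m)) (vertex 0))
            (cong₂ (λ a b → det (num a , den a) (num b , den b)) first last)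

  frieze : ℤ → ℤ → ℤ
  frieze i j = det (U (i - + 1)) (U (j + + 1))

  -- The Plücker relation gives the unimodular rule, convexity gives positivity,
  -- and antiperiodicity gives the right border of zeros and ones.
  frieze-isFrieze : Frieze n frieze
  frieze-isFrieze = record
    { zeroˡ      = λ i → trans (cong (λ z → det (U (i - + 1)) (U z)) (left-border i)) (det-self (U (i - + 1)))
    ; zeroʳ      = λ i → begin
        det (U (i - + 1)) (U (i + + n - + 2 + + 1))   ≡⟨ cong (λ z → det (U (i - + 1)) (U z)) (right-zero-col i (+ n)) ⟩
        det (U (i - + 1)) (U (i - + 1 + + n))         ≡⟨ cong (det (U (i - + 1))) (U-shift (i - + 1)) ⟩
        det (U (i - + 1)) (neg (U (i - + 1)))         ≡⟨ det-negʳ (U (i - + 1)) (U (i - + 1)) ⟩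
        det (U (i - + 1)) (U (i - + 1))               ≡⟨ det-self (U (i - + 1)) ⟩
        + 0                                           ∎
    ; oneˡ       = λ i → det-adjacent (i - + 1)
    ; oneʳ       = λ i → begin
        det (U (i - + 1)) (U (i + + n - + 3 + + 1))   ≡⟨ cong (λ z → det (U (i - + 1)) (U z)) (right-one-col i (+ n)) ⟩
        det (U (i - + 1)) (U (i - + 2 + + n))         ≡⟨ cong (det (U (i - + 1))) (U-shift (i - + 2)) ⟩
        det (U (i - + 1)) (neg (U (i - + 2)))         ≡⟨ det-negʳ (U (i - + 1)) (U (i - + 2)) ⟩
        det (U (i - + 2)) (U (i - + 1))               ≡⟨ cong (λ z → det (U (i - + 2)) (U z)) (left-border i) ⟨
        det (U (i - + 2)) (U (i - + 2 + + 1))         ≡⟨ det-adjacent (i - + 2) ⟩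
        + 1                                           ∎
    ; unimodular = λ i j _ _ _ _ → begin
        frieze i j * frieze (i + + 1) (j + + 1) - frieze i (j + + 1) * frieze (i + + 1) j
          ≡⟨ plücker (U (i - + 1)) (U (i + + 1 - + 1)) (U (j + + 1)) (U (j + + 1 + + 1)) ⟩
        det (U (i - + 1)) (U (i + + 1 - + 1)) * det (U (j + + 1)) (U (j + + 1 + + 1))
          ≡⟨ cong₂ _*_ (trans (cong (λ z → det (U (i - + 1)) (U z)) (next-row i)) (det-adjacent (i - + 1)))
                       (det-adjacent (j + + 1)) ⟩
        + 1                                           ∎
    ; positive   = frieze-positive
    }
    where
    open ≡-Reasoning
    left-border : ∀ i → i - + 2 + + 1 ≡ i - + 1
    left-border = solve-∀
    right-zero-col : ∀ i N → i + N - + 2 + + 1 ≡ i - + 1 + N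
    right-zero-col = solve-∀
    right-one-col : ∀ i N → i + N - + 3 + + 1 ≡ i - + 2 + N
    right-one-col = solve-∀
    next-row : ∀ i → i + + 1 - + 1 ≡ i - + 1 + + 1
    next-row = solve-∀
    frieze-positive : ∀ i j → i ℤ.≤ j → j ℤ.≤ i + + n - + 4 → + 0 ℤ.< frieze i j
    frieze-positive i j i≤j j≤ with ≤⇒offset i≤j
    ... | t , refl = subst (λ z → + 0 ℤ.< det (U (i - + 1)) (U z)) (sym (two-more i (+ t)))
        (det-positive (i - + 1) (t ℕ.+ 2) (ℕP.≤-trans (ℕP.n≤1+n 1) (ℕP.m≤n+m 2 t)) (ℕP.<-≤-trans (ℕP.+-monoʳ-< t (s≤s (s≤s (s≤s z≤n)))) t+4≤n))
      where
      two-more : ∀ i T → i + T + + 1 ≡ i - + 1 + (T + + 2)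
      two-more = solve-∀
      four-more : ∀ i N → i + N - + 4 + + 4 ≡ i + N
      four-more = solve-∀
      t+4≤n : t ℕ.+ 4 ≤ n
      t+4≤n = offset-cancel i (t ℕ.+ 4) n
        (subst₂ ℤ._≤_ (ℤP.+-assoc i (+ t) (+ 4)) (four-more i (+ n)) (ℤP.+-monoˡ-≤ (+ 4) j≤))

  frieze-row₀ : ∀ j → j < n → frieze (+ 0) (- + 1 + + j) ≡ num (v j)
  frieze-row₀ j j<n = begin
      det (U (- + 1)) (U (- + 1 + + j + + 1))   ≡⟨ cong (λ z → det (U (- + 1)) (U z)) (cancel (+ j)) ⟩
      det (U (- + 1)) (U (+ j))                 ≡⟨ cong (det (U (- + 1))) (U-base j j<n) ⟩
      det (neg (vertex (2 ℕ.+ m))) (vertex j)   ≡⟨ cong (λ w → det (neg (num w , den w)) (vertex j)) last ⟩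
      det (neg (+ 0 , + 1)) (vertex j)          ≡⟨ pick-num (num (v j)) (den (v j)) ⟩
      num (v j)                                 ∎
    where
    open ≡-Reasoning
    cancel : ∀ J → - + 1 + J + + 1 ≡ J
    cancel = solve-∀
    pick-num : ∀ a b → - + 0 * b - a * (- + 1) ≡ a
    pick-num = solve-∀

  frieze-row₁ : ∀ j → j < n → frieze (+ 1) (- + 1 + + j) ≡ den (v j)
  frieze-row₁ j j<n = begin
      det (U (+ 0)) (U (- + 1 + + j + + 1))     ≡⟨ cong (λ z → det (U (+ 0)) (U z)) (cancel (+ j)) ⟩
      det (U (+ 0)) (U (+ j))                   ≡⟨ cong (det (U (+ 0))) (U-base j j<n) ⟩
      det (vertex 0) (vertex j)                 ≡⟨ cong (λ w → det (num w , den w) (vertex j)) first ⟩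
      det (+ 1 , + 0) (vertex j)                ≡⟨ pick-den (num (v j)) (den (v j)) ⟩
      den (v j)                                 ∎
    where
    open ≡-Reasoning
    cancel : ∀ J → - + 1 + J + + 1 ≡ J
    cancel = solve-∀
    pick-den : ∀ a b → + 1 * b - a * + 0 ≡ b
    pick-den = solve-∀

  polygon-rowRatios : SameSeq n v (rowRatios (band frieze) (+ 0))
  polygon-rowRatios j j<n = begin
      v j                                       ≡⟨ frac-numden (v j) ⟨
      frac (num (v j)) (den (v j))              ≡⟨ cong₂ frac (frieze-row₀ j j<n) (frieze-row₁ j j<n) ⟨
      ratios frieze (+ 0) j                     ≡⟨ ratios-rowRatios frieze (+ 0) j j<n ⟩
      rowRatios (band frieze) (+ 0) j           ∎
    where open ≡-Reasoning

-- Cyclic moves preserve being the row ratios of a fixed band frieze e': forward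
-- moves by rotation-unique; a backward move x ↦ z is undone by building the
-- frieze of x, whose rows 1, 2 give z and hence agree with two rows of e'.
module Injectivity {m : ℕ} {e' : ℤ → ℕ → ℤ} (B' : BandFrieze m e') where

  private
    n : ℕ
    n = 3 ℕ.+ m

  IsRowRatios : (ℕ → ℚ∞) → Set
  IsRowRatios w = Σ ℤ λ K → SameSeq n w (rowRatios e' K)

  rotate-forward : ∀ z x → Rotate n z x → IsRowRatios z → IsRowRatios x
  rotate-forward z x z↻x (K , z≡) = K + + 1 , BandFacts.rotation-unique B' K z x z≡ z↻x

  rotate-backward : ∀ x z → Rotate n x z → IsRowRatios z → IsRowRatios x
  rotate-backward x z x↻z (K , z≡) =
    + 0 + (K - + 1) , λ j j<n → trans (polygon-rowRatios j j<n) (shifted-rowRatios {e = e'} (K - + 1) e≡e' (+ 0) j j<n)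
    where
    open PolygonFrieze m x (proj₁ x↻z)
    B = FriezeBand.band-isBandFrieze frieze-isFrieze
    z≡rows₁ : SameSeq n z (rowRatios (band frieze) (+ 1))
    z≡rows₁ = BandFacts.rotation-unique B (+ 0) x z polygon-rowRatios x↻z
    e≡e' : ∀ i t → t ≤ n → band frieze i t ≡ e' (i + (K - + 1)) t
    e≡e' = rowRatios-injective B' B K (+ 1) (λ j j<n → trans (sym (z≡ j j<n)) (z≡rows₁ j j<n))

  private
    step-backward : ∀ x z → CycStep n x z → IsRowRatios z → IsRowRatios x
    step-backward x z (inj₁ x≡z) (K , z≡) = K , λ j j<n → trans (x≡z j j<n) (z≡ j j<n)
    step-backward x z (inj₂ x↻z) rz       = rotate-backward x z x↻z rz

    step-forward : ∀ z x → CycStep n z x → IsRowRatios z → IsRowRatios x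
    step-forward z x (inj₁ z≡x) (K , z≡) = K , λ j j<n → trans (sym (z≡x j j<n)) (z≡ j j<n)
    step-forward z x (inj₂ z↻x) rz       = rotate-forward z x z↻x rz

  cyclic-closed : ∀ {x y} → CycEq n x y → IsRowRatios y → IsRowRatios x
  cyclic-closed ε                  ry = ry
  cyclic-closed (fwd step ◅ steps) ry = step-backward _ _ step (cyclic-closed steps ry)
  cyclic-closed (bwd step ◅ steps) ry = step-forward _ _ step (cyclic-closed steps ry)

cyclic⇒shift : ∀ {m e e'} → BandFrieze m e → BandFrieze m e' → ∀ k k' →
  CycEq (3 ℕ.+ m) (rowRatios e k) (rowRatios e' k') →
  Σ ℤ λ s → ∀ i t → t ≤ 3 ℕ.+ m → e' i t ≡ e (i + s) t
cyclic⇒shift B B' k k' k~k' with Injectivity.cyclic-closed B' k~k' (k' , λ _ _ → refl)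
... | K , same = k - K , rowRatios-injective B B' k K same

NormFareyPolygon-resp : ∀ {n v w} → SameSeq (suc n) v w → NormFareyPolygon (suc n) w → NormFareyPolygon (suc n) v
NormFareyPolygon-resp {n} {v} at P = record
  { polygon = record
    { top       = ∞≥
    ; decr      = λ i i+1<n → subst₂ _>∞_ (sym (at i (ℕP.<-trans (ℕP.n<1+n i) i+1<n))) (sym (at (suc i) i+1<n)) (decr i i+1<n)
    ; bottom    = subst (_≥∞ fin 0ℚ) (sym (at n ℕP.≤-refl)) bottom
    ; edges     = λ i i+1<n → subst₂ FareyEdge (sym (at i (ℕP.<-trans (ℕP.n<1+n i) i+1<n))) (sym (at (suc i) i+1<n)) (edges i i+1<n)
    ; closeEdge = subst₂ FareyEdge (sym (at n ℕP.≤-refl)) (sym (at 0 z<s)) closeEdge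
    }
  ; first   = trans (at 0 z<s) first
  ; last    = trans (at n ℕP.≤-refl) last
  }
  where
  open NormFareyPolygon P
  open FareyPolygon polygon

proposition2p7 : ∀ (n : ℕ) → 3 ≤ n →
    (∀ c → Frieze n c → ∀ k → NormFareyPolygon n (ratios c k))
    × (∀ c → Frieze n c → ∀ k k' → CycEq n (ratios c k) (ratios c k'))
    × (∀ c c' → Frieze n c → Frieze n c' → ShiftEq n c c' →
         ∀ k k' → CycEq n (ratios c k) (ratios c' k'))
    × (∀ c c' → Frieze n c → Frieze n c' → ∀ k k' →
         CycEq n (ratios c k) (ratios c' k') → ShiftEq n c c')
    × (∀ v → NormFareyPolygon n v →
         ∃ λ c → Frieze n c ×
           (∀ j → j < n →
              (c (+ 0) (ℤ.- + 1 ℤ.+ + j) ≡ num (v j))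
              × (c (+ 1) (ℤ.- + 1 ℤ.+ + j) ≡ den (v j))))
proposition2p7 (suc (suc zero)) (s≤s (s≤s ()))
proposition2p7 (suc (suc (suc m))) _ =
  ratios-polygon , ratios-cyclic , shift⇒cyclic , cyclic⇒shiftEq , polygon⇒frieze
  where
  n = 3 ℕ.+ m
  open BandIndex n
  open import Relation.Binary.Reasoning.Setoid (EqClosure.setoid (CycStep n))

  bandOf : ∀ {c} → Frieze n c → BandFrieze m (band c)
  bandOf = FriezeBand.band-isBandFrieze

  ratios-polygon : ∀ c → Frieze n c → ∀ k → NormFareyPolygon n (ratios c k)
  ratios-polygon c F k = NormFareyPolygon-resp (ratios-rowRatios c k) (BandFacts.rowRatios-polygon (bandOf F) k)

  ratios-cyclic : ∀ c → Frieze n c → ∀ k k' → CycEq n (ratios c k) (ratios c k')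
  ratios-cyclic c F k k' = begin
    ratios c k             ≈⟨ same-cyc (ratios-rowRatios c k) ⟩
    rowRatios (band c) k   ≈⟨ BandFacts.rowRatios-cyclic (bandOf F) k k' ⟩
    rowRatios (band c) k'  ≈⟨ same-cyc (ratios-rowRatios c k') ⟨
    ratios c k'            ∎

  shift⇒cyclic : ∀ c c' → Frieze n c → Frieze n c' → ShiftEq n c c' → ∀ k k' → CycEq n (ratios c k) (ratios c' k')
  shift⇒cyclic c c' F _ c~c' k k' with shiftEq⇒band {c} {c'} c~c'
  ... | s , c'≡c = begin
    ratios c k                   ≈⟨ same-cyc (ratios-rowRatios c k) ⟩
    rowRatios (band c) k         ≈⟨ BandFacts.rowRatios-cyclic (bandOf F) k (k' + s) ⟩
    rowRatios (band c) (k' + s)  ≈⟨ same-cyc (shifted-rowRatios {e = band c} s c'≡c k') ⟨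
    rowRatios (band c') k'       ≈⟨ same-cyc (ratios-rowRatios c' k') ⟨
    ratios c' k'                 ∎

  cyclic⇒shiftEq : ∀ c c' → Frieze n c → Frieze n c' → ∀ k k' → CycEq n (ratios c k) (ratios c' k') → ShiftEq n c c'
  cyclic⇒shiftEq c c' F F' k k' k~k' =
    let s , c'≡c = cyclic⇒shift (bandOf F) (bandOf F') k k' rows-cyclic in band⇒shiftEq {c} {c'} s c'≡c
    where
    rows-cyclic : CycEq n (rowRatios (band c) k) (rowRatios (band c') k')
    rows-cyclic = begin
      rowRatios (band c) k     ≈⟨ same-cyc (ratios-rowRatios c k) ⟨
      ratios c k               ≈⟨ k~k' ⟩
      ratios c' k'             ≈⟨ same-cyc (ratios-rowRatios c' k') ⟩
      rowRatios (band c') k'   ∎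

  polygon⇒frieze : ∀ v → NormFareyPolygon n v → ∃ λ c → Frieze n c ×
    (∀ j → j < n → (c (+ 0) (ℤ.- + 1 ℤ.+ + j) ≡ num (v j)) × (c (+ 1) (ℤ.- + 1 ℤ.+ + j) ≡ den (v j)))
  polygon⇒frieze v P = frieze , frieze-isFrieze , λ j j<n → frieze-row₀ j j<n , frieze-row₁ j j<n
    where open PolygonFrieze m v P
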